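{- Let $\ell$ be a prime and let $r$ be an integer with $1\leq r\leq \ell-1$ such that $p(\ell n+r)\equiv 0\pmod{\ell}$ for all $n\geq 0$, where $p(n)$ is the number of unrestricted partitions of $n$. Then for all $n\geq 0$, $d_\ell(\ell n+r)\equiv 0\pmod{\ell}$.
   Context: For each integer $k\geq 1$, the numbers $d_k(n)$ ($n\geq 0$) are defined by the generating function $\sum_{n\geq 0} d_k(n)q^n = \frac{f_2^k}{f_1^{3k+1}}$, where $f_r=\prod_{i\geq 1}(1-q^{ri})$. -}

module Defs where

open import Data.Nat as ℕ using (ℕ; zero; suc; _∸_; _/_)
open import Data.Integer as ℤ using (ℤ; +_; _+_; _*_; -_)
open import Data.List using (List; []; _∷_; map; upTo)
import Data.List as L
open import Data.Nat.ListAction using (sum)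
open import Data.Nat.Divisibility using (_∣?_)
open import Relation.Nullary.Decidable using (does)
open import Data.Bool using (if_then_else_)

-- Number of partitions of n into parts of size at most m,
-- counting by the multiplicity j of the largest allowed part m.
pBounded : ℕ → ℕ → ℕ
pBounded zero    zero    = 1
pBounded (suc _) zero    = 0
pBounded n (suc m) =
  sum (map (λ j → pBounded (n ∸ j ℕ.* suc m) m) (upTo (suc (n / suc m))))

p : ℕ → ℕ
p n = pBounded n n

Series : Set
Series = ℕ → ℤ

sumℤ : List ℤ → ℤ
sumℤ = L.foldr _+_ (+ 0)

_⊛_ : Series → Series → Series
(A ⊛ B) n = sumℤ (map (λ i → A i * B (n ∸ i)) (upTo (suc n)))

one : Series
one zero    = + 1
one (suc _) = + 0

_^ˢ_ : Series → ℕ → Series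
A ^ˢ zero  = one
A ^ˢ suc k = A ⊛ (A ^ˢ k)

oneMinusQ : ℕ → Series
oneMinusQ m n = if does (n ℕ.≟ 0) then + 1 else (if does (n ℕ.≟ m) then - (+ 1) else + 0)

fTrunc : ℕ → ℕ → Series
fTrunc r zero    = one
fTrunc r (suc N) = oneMinusQ (r ℕ.* suc N) ⊛ fTrunc r N

-- f_r = ∏_{i≥1} (1 - q^{r i}); for r ≥ 1 the coefficient of q^n is
-- already determined by the factors with i ≤ n.
f : ℕ → Series
f r n = fTrunc r n n

-- 1/(1 - q^m) = Σ_{j≥0} q^{m j}   (for m ≥ 1)
geom : ℕ → Series
geom m n = if does (m ∣? n) then + 1 else + 0

invF1Trunc : ℕ → Series
invF1Trunc zero    = one
invF1Trunc (suc N) = geom (suc N) ⊛ invF1Trunc N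

-- 1/f_1 = ∏_{i≥1} 1/(1 - q^i); coefficient of q^n determined by i ≤ n.
invF1 : Series
invF1 n = invF1Trunc n n

d : ℕ → ℕ → ℤ
d k = (f 2 ^ˢ k) ⊛ (invF1 ^ˢ (3 ℕ.* k ℕ.+ 1))

module Submission where

-- For a prime ℓ, every ℓ-th power B^ℓ of an integer power series is congruent modulo ℓ to a
-- series in q^ℓ: applying q d/dq gives m·[qᵐ]B^ℓ = ℓ·[qᵐ](q B′ B^(ℓ-1)), and Euclid's lemma does the
-- rest.  Hence G = f₂^ℓ / f₁^(3ℓ) is such a series, and since 1/f₁ = Σ p(n) qⁿ,
--   d_ℓ(ℓn + r) = Σ_i [qⁱ]G · p(ℓn + r - i) ≡ Σ_j [q^(ℓj)]G · p(ℓ(n - j) + r) ≡ 0  (mod ℓ).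

open import Defs
open import Data.Empty using (⊥-elim)
open import Data.Integer using (ℤ; +_; _+_; _*_; ∣_∣)
open import Data.Integer.Properties
import Data.Integer.Divisibility as ℤD
open import Data.Integer.Divisibility.Signed as ℤ∣ using (∣ᵤ⇒∣; ∣⇒∣ᵤ) renaming (_∣_ to _∣ℤ_)
open import Data.Integer.Solver using (module +-*-Solver)
open import Data.List using ([]; _∷_; map; upTo; applyUpTo)
open import Data.Nat as ℕ using (ℕ; zero; suc; _∸_; _<_; _≤_; s≤s; z≤n; NonZero)
import Data.Nat.Properties as ℕP
open import Data.Nat.DivMod using (_/_; _%_; m≡m%n+[m/n]*n; m%n<n; [m+kn]%n≡m%n; m<n⇒m%n≡m; m*n≤o⇒[o∸m*n]%n≡o%n)
open import Data.Nat.Divisibility using (_∣_; _∣?_; divides; _∣0; ∣-refl; ∣⇒≤; ∣m∸n∣n⇒∣m; ∣m∣n⇒∣m+n; ∣m+n∣m⇒∣n; m∣m*n)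
open import Data.Nat.ListAction using (sum)
open import Data.Nat.Primality using (Prime; euclidsLemma)
open import Data.Sum using (inj₁; inj₂)
open import Relation.Binary.PropositionalEquality
open import Relation.Nullary using (¬_; yes; no)
open import Relation.Nullary.Decidable using (dec-true; dec-false)
open +-*-Solver

opaque
  ∑ : ℕ → (ℕ → ℤ) → ℤ
  ∑ zero    f = + 0
  ∑ (suc k) f = f 0 + ∑ k (λ i → f (suc i))

  sumℤ-applyUpTo : ∀ k (f : ℕ → ℤ) (g : ℕ → ℕ) → sumℤ (map f (applyUpTo g k)) ≡ ∑ k (λ i → f (g i))
  sumℤ-applyUpTo zero    f g = refl
  sumℤ-applyUpTo (suc k) f g = cong (_+_ (f (g 0))) (sumℤ-applyUpTo k f (λ i → g (suc i)))

  ∑-cong-< : ∀ k {f g : ℕ → ℤ} → (∀ i → i < k → f i ≡ g i) → ∑ k f ≡ ∑ k g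
  ∑-cong-< zero    eq = refl
  ∑-cong-< (suc k) eq = cong₂ _+_ (eq 0 (s≤s z≤n)) (∑-cong-< k (λ i i<k → eq (suc i) (s≤s i<k)))

  ∑-zero : ∀ k (f : ℕ → ℤ) → (∀ i → i < k → f i ≡ + 0) → ∑ k f ≡ + 0
  ∑-zero zero    f eq = refl
  ∑-zero (suc k) f eq = cong₂ _+_ (eq 0 (s≤s z≤n)) (∑-zero k _ (λ i i<k → eq (suc i) (s≤s i<k)))

  ∑-distrib-+ : ∀ k (f g : ℕ → ℤ) → ∑ k (λ i → f i + g i) ≡ ∑ k f + ∑ k g
  ∑-distrib-+ zero    f g = refl
  ∑-distrib-+ (suc k) f g = trans (cong (_+_ (f 0 + g 0)) (∑-distrib-+ k _ _))
    (solve 4 (λ a b c d → (a :+ b) :+ (c :+ d) := (a :+ c) :+ (b :+ d)) refl (f 0) (g 0) (∑ k _) (∑ k _))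

  *-distribˡ-∑ : ∀ k c (f : ℕ → ℤ) → c * ∑ k f ≡ ∑ k (λ i → c * f i)
  *-distribˡ-∑ zero    c f = *-zeroʳ c
  *-distribˡ-∑ (suc k) c f = trans (*-distribˡ-+ c (f 0) _) (cong (_+_ (c * f 0)) (*-distribˡ-∑ k c _))

  ∑-suc-last : ∀ k (f : ℕ → ℤ) → ∑ (suc k) f ≡ ∑ k f + f k
  ∑-suc-last zero    f = +-comm (f 0) (+ 0)
  ∑-suc-last (suc k) f = trans (cong (_+_ (f 0)) (∑-suc-last k (λ i → f (suc i)))) (sym (+-assoc (f 0) _ _))

  ∑-split : ∀ a b (f : ℕ → ℤ) → ∑ (a ℕ.+ b) f ≡ ∑ a f + ∑ b (λ i → f (a ℕ.+ i))
  ∑-split zero    b f = sym (+-identityˡ _)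
  ∑-split (suc a) b f = trans (cong (_+_ (f 0)) (∑-split a b (λ i → f (suc i)))) (sym (+-assoc (f 0) _ _))

  ∑-∣ : ∀ {c} k (f : ℕ → ℤ) → (∀ i → i < k → c ∣ℤ f i) → c ∣ℤ ∑ k f
  ∑-∣ zero    f c∣f = ∣ᵤ⇒∣ (_ ∣0)
  ∑-∣ (suc k) f c∣f = ℤ∣.∣m∣n⇒∣m+n (c∣f 0 (s≤s z≤n)) (∑-∣ k _ (λ i i<k → c∣f (suc i) (s≤s i<k)))

  ∑-reverse : ∀ k (f : ℕ → ℤ) → ∑ k f ≡ ∑ k (λ i → f (k ∸ suc i))
  ∑-reverse zero    f = refl
  ∑-reverse (suc k) f = begin
      f 0 + ∑ k (λ i → f (suc i))
    ≡⟨ cong (_+_ (f 0)) (∑-reverse k (λ i → f (suc i))) ⟩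
      f 0 + ∑ k (λ i → f (suc (k ∸ suc i)))
    ≡⟨ cong (_+_ (f 0)) (∑-cong-< k (λ i i<k → cong f (sym (ℕP.+-∸-assoc 1 i<k)))) ⟩
      f 0 + ∑ k (λ i → f (k ∸ i))
    ≡⟨ +-comm (f 0) _ ⟩
      ∑ k (λ i → f (k ∸ i)) + f 0
    ≡⟨ cong (λ j → ∑ k (λ i → f (k ∸ i)) + f j) (sym (ℕP.n∸n≡0 k)) ⟩
      ∑ k (λ i → f (k ∸ i)) + f (k ∸ k)
    ≡⟨ sym (∑-suc-last k (λ i → f (k ∸ i))) ⟩
      ∑ (suc k) (λ i → f (suc k ∸ suc i)) ∎
    where open ≡-Reasoning

  ∑-suc : ∀ k (f : ℕ → ℤ) → ∑ (suc k) f ≡ f 0 + ∑ k (λ i → f (suc i))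
  ∑-suc k f = refl

  ∑-one : ∀ (f : ℕ → ℤ) → ∑ 1 f ≡ f 0
  ∑-one f = +-identityʳ (f 0)

∑-cong : ∀ k {f g : ℕ → ℤ} → (∀ i → f i ≡ g i) → ∑ k f ≡ ∑ k g
∑-cong k eq = ∑-cong-< k (λ i _ → eq i)

*-distribʳ-∑ : ∀ k c (f : ℕ → ℤ) → ∑ k f * c ≡ ∑ k (λ i → f i * c)
*-distribʳ-∑ k c f = trans (*-comm _ c) (trans (*-distribˡ-∑ k c f) (∑-cong k (λ i → *-comm c (f i))))

∑-triangle : ∀ n (F : ℕ → ℕ → ℤ) →
  ∑ (suc n) (λ i → ∑ (suc i) (λ j → F i j)) ≡ ∑ (suc n) (λ j → ∑ (suc (n ∸ j)) (λ k → F (j ℕ.+ k) j))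
∑-triangle zero    F = trans (∑-one _) (trans (∑-one _) (sym (trans (∑-one _) (∑-one _))))
∑-triangle (suc n) F = begin
    ∑ (suc (suc n)) (λ i → ∑ (suc i) (F i))
  ≡⟨ ∑-suc-last (suc n) _ ⟩
    ∑ (suc n) (λ i → ∑ (suc i) (F i)) + ∑ (suc (suc n)) (F (suc n))
  ≡⟨ cong₂ _+_ (∑-triangle n F) (∑-suc-last (suc n) _) ⟩
    R + (∑ (suc n) (F (suc n)) + F (suc n) (suc n))
  ≡⟨ sym (+-assoc R _ _) ⟩
    (R + ∑ (suc n) (F (suc n))) + F (suc n) (suc n)
  ≡⟨ cong₂ _+_ (sym (∑-distrib-+ (suc n) _ _)) (cong (λ t → F t (suc n)) (sym (ℕP.+-identityʳ (suc n)))) ⟩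
    ∑ (suc n) (λ j → ∑ (suc (n ∸ j)) (λ k → F (j ℕ.+ k) j) + F (suc n) j) + F (suc n ℕ.+ 0) (suc n)
  ≡⟨ cong₂ _+_ (∑-cong-< (suc n) extend-column) last-column ⟩
    ∑ (suc n) (λ j → ∑ (suc (suc n ∸ j)) (λ k → F (j ℕ.+ k) j))
      + ∑ (suc (suc n ∸ suc n)) (λ k → F (suc n ℕ.+ k) (suc n))
  ≡⟨ sym (∑-suc-last (suc n) (λ j → ∑ (suc (suc n ∸ j)) (λ k → F (j ℕ.+ k) j))) ⟩
    ∑ (suc (suc n)) (λ j → ∑ (suc (suc n ∸ j)) (λ k → F (j ℕ.+ k) j)) ∎
  where
  open ≡-Reasoning
  R = ∑ (suc n) (λ j → ∑ (suc (n ∸ j)) (λ k → F (j ℕ.+ k) j))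
  last-column : F (suc n ℕ.+ 0) (suc n) ≡ ∑ (suc (suc n ∸ suc n)) (λ k → F (suc n ℕ.+ k) (suc n))
  last-column = sym (trans (cong (λ t → ∑ (suc t) (λ k → F (suc n ℕ.+ k) (suc n))) (ℕP.n∸n≡0 n)) (∑-one _))
  extend-column : ∀ j → j < suc n →
    ∑ (suc (n ∸ j)) (λ k → F (j ℕ.+ k) j) + F (suc n) j ≡ ∑ (suc (suc n ∸ j)) (λ k → F (j ℕ.+ k) j)
  extend-column j j<sn = begin
      ∑ (suc (n ∸ j)) (λ k → F (j ℕ.+ k) j) + F (suc n) j
    ≡⟨ cong (λ t → ∑ (suc (n ∸ j)) (λ k → F (j ℕ.+ k) j) + F t j)
         (sym (trans (ℕP.+-suc j (n ∸ j)) (cong suc (ℕP.m+[n∸m]≡n (ℕP.≤-pred j<sn))))) ⟩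
      ∑ (suc (n ∸ j)) (λ k → F (j ℕ.+ k) j) + F (j ℕ.+ suc (n ∸ j)) j
    ≡⟨ sym (∑-suc-last (suc (n ∸ j)) (λ k → F (j ℕ.+ k) j)) ⟩
      ∑ (suc (suc (n ∸ j))) (λ k → F (j ℕ.+ k) j)
    ≡⟨ cong (λ t → ∑ (suc t) (λ k → F (j ℕ.+ k) j)) (sym (ℕP.+-∸-assoc 1 (ℕP.≤-pred j<sn))) ⟩
      ∑ (suc (suc n ∸ j)) (λ k → F (j ℕ.+ k) j) ∎

⊛-coeff : ∀ (A B : Series) n → (A ⊛ B) n ≡ ∑ (suc n) (λ i → A i * B (n ∸ i))
⊛-coeff A B n = sumℤ-applyUpTo (suc n) (λ i → A i * B (n ∸ i)) (λ i → i)

infix 4 _≈_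
_≈_ : Series → Series → Set
A ≈ B = ∀ n → A n ≡ B n

≈-sym : ∀ {A B} → A ≈ B → B ≈ A
≈-sym A≈B n = sym (A≈B n)

≈-trans : ∀ {A B C} → A ≈ B → B ≈ C → A ≈ C
≈-trans A≈B B≈C n = trans (A≈B n) (B≈C n)

⊛-cong : ∀ {A A′ B B′ : Series} → A ≈ A′ → B ≈ B′ → A ⊛ B ≈ A′ ⊛ B′
⊛-cong {A} {A′} {B} {B′} A≈A′ B≈B′ n = begin
    (A ⊛ B) n                                 ≡⟨ ⊛-coeff A B n ⟩
    ∑ (suc n) (λ i → A i * B (n ∸ i))         ≡⟨ ∑-cong (suc n) (λ i → cong₂ _*_ (A≈A′ i) (B≈B′ (n ∸ i))) ⟩
    ∑ (suc n) (λ i → A′ i * B′ (n ∸ i))       ≡⟨ ⊛-coeff A′ B′ n ⟨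
    (A′ ⊛ B′) n                               ∎
  where open ≡-Reasoning

⊛-congˡ : ∀ A {B B′ : Series} → B ≈ B′ → A ⊛ B ≈ A ⊛ B′
⊛-congˡ A = ⊛-cong {A} {A} (λ _ → refl)

⊛-comm : ∀ A B → A ⊛ B ≈ B ⊛ A
⊛-comm A B n = begin
    (A ⊛ B) n                                          ≡⟨ ⊛-coeff A B n ⟩
    ∑ (suc n) (λ i → A i * B (n ∸ i))                  ≡⟨ ∑-reverse (suc n) (λ i → A i * B (n ∸ i)) ⟩
    ∑ (suc n) (λ i → A (n ∸ i) * B (n ∸ (n ∸ i)))      ≡⟨ ∑-cong-< (suc n) swap ⟩
    ∑ (suc n) (λ i → B i * A (n ∸ i))                  ≡⟨ ⊛-coeff B A n ⟨
    (B ⊛ A) n                                          ∎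
  where
  open ≡-Reasoning
  swap : ∀ i → i < suc n → A (n ∸ i) * B (n ∸ (n ∸ i)) ≡ B i * A (n ∸ i)
  swap i i<sn = trans (cong (λ t → A (n ∸ i) * B t) (ℕP.m∸[m∸n]≡n (ℕP.≤-pred i<sn)))
                      (*-comm (A (n ∸ i)) (B i))

⊛-identityˡ : ∀ A → one ⊛ A ≈ A
⊛-identityˡ A n = begin
    (one ⊛ A) n
  ≡⟨ ⊛-coeff one A n ⟩
    ∑ (suc n) (λ i → one i * A (n ∸ i))
  ≡⟨ ∑-suc n _ ⟩
    + 1 * A n + ∑ n (λ i → + 0 * A (n ∸ suc i))
  ≡⟨ cong₂ _+_ (*-identityˡ (A n)) (∑-zero n _ (λ i _ → *-zeroˡ (A (n ∸ suc i)))) ⟩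
    A n + + 0
  ≡⟨ +-identityʳ (A n) ⟩
    A n ∎
  where open ≡-Reasoning

⊛-identityʳ : ∀ A → A ⊛ one ≈ A
⊛-identityʳ A = ≈-trans (⊛-comm A one) (⊛-identityˡ A)

⊛-assoc : ∀ A B C → (A ⊛ B) ⊛ C ≈ A ⊛ (B ⊛ C)
⊛-assoc A B C n = begin
    ((A ⊛ B) ⊛ C) n
  ≡⟨ ⊛-coeff (A ⊛ B) C n ⟩
    ∑ (suc n) (λ i → (A ⊛ B) i * C (n ∸ i))
  ≡⟨ ∑-cong (suc n) (λ i → trans (cong (_* C (n ∸ i)) (⊛-coeff A B i))
                                  (*-distribʳ-∑ (suc i) (C (n ∸ i)) (λ j → A j * B (i ∸ j)))) ⟩
    ∑ (suc n) (λ i → ∑ (suc i) (λ j → A j * B (i ∸ j) * C (n ∸ i)))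
  ≡⟨ ∑-triangle n (λ i j → A j * B (i ∸ j) * C (n ∸ i)) ⟩
    ∑ (suc n) (λ j → ∑ (suc (n ∸ j)) (λ k → A j * B (j ℕ.+ k ∸ j) * C (n ∸ (j ℕ.+ k))))
  ≡⟨ ∑-cong (suc n) (λ j → ∑-cong (suc (n ∸ j)) (λ k →
       trans (cong₂ (λ u v → A j * B u * C v) (ℕP.m+n∸m≡n j k) (sym (ℕP.∸-+-assoc n j k)))
             (*-assoc (A j) _ _))) ⟩
    ∑ (suc n) (λ j → ∑ (suc (n ∸ j)) (λ k → A j * (B k * C (n ∸ j ∸ k))))
  ≡⟨ ∑-cong (suc n) (λ j → trans (sym (*-distribˡ-∑ (suc (n ∸ j)) (A j) (λ k → B k * C (n ∸ j ∸ k))))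
                                  (cong (A j *_) (sym (⊛-coeff B C (n ∸ j))))) ⟩
    ∑ (suc n) (λ j → A j * (B ⊛ C) (n ∸ j))
  ≡⟨ ⊛-coeff A (B ⊛ C) n ⟨
    (A ⊛ (B ⊛ C)) n ∎
  where open ≡-Reasoning

⊛-lcomm : ∀ A B C → A ⊛ (B ⊛ C) ≈ B ⊛ (A ⊛ C)
⊛-lcomm A B C = ≈-trans (≈-sym (⊛-assoc A B C))
  (≈-trans (⊛-cong {B = C} {B′ = C} (⊛-comm A B) (λ _ → refl)) (⊛-assoc B A C))

^ˢ-+ : ∀ A a b → A ^ˢ (a ℕ.+ b) ≈ (A ^ˢ a) ⊛ (A ^ˢ b)
^ˢ-+ A zero    b = ≈-sym (⊛-identityˡ (A ^ˢ b))
^ˢ-+ A (suc a) b = ≈-trans (⊛-congˡ A (^ˢ-+ A a b)) (≈-sym (⊛-assoc A (A ^ˢ a) (A ^ˢ b)))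

infixr 7 _·_
_·_ : ℤ → Series → Series
(c · A) n = c * A n

⊛-· : ∀ A c B → A ⊛ (c · B) ≈ c · (A ⊛ B)
⊛-· A c B n = begin
    (A ⊛ (c · B)) n                            ≡⟨ ⊛-coeff A (c · B) n ⟩
    ∑ (suc n) (λ i → A i * (c * B (n ∸ i)))    ≡⟨ ∑-cong (suc n) (λ i → x*[y*z]≡y*[x*z] (A i) c (B (n ∸ i))) ⟩
    ∑ (suc n) (λ i → c * (A i * B (n ∸ i)))    ≡⟨ *-distribˡ-∑ (suc n) c (λ i → A i * B (n ∸ i)) ⟨
    c * ∑ (suc n) (λ i → A i * B (n ∸ i))      ≡⟨ cong (c *_) (⊛-coeff A B n) ⟨
    c * (A ⊛ B) n                              ∎
  where
  open ≡-Reasoning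
  x*[y*z]≡y*[x*z] : ∀ x y z → x * (y * z) ≡ y * (x * z)
  x*[y*z]≡y*[x*z] = solve 3 (λ x y z → x :* (y :* z) := y :* (x :* z)) refl

∂ : Series → Series
∂ A n = + n * A n

∂-⊛ : ∀ A B n → ∂ (A ⊛ B) n ≡ (∂ A ⊛ B) n + (A ⊛ ∂ B) n
∂-⊛ A B n = begin
    + n * (A ⊛ B) n
  ≡⟨ cong (+ n *_) (⊛-coeff A B n) ⟩
    + n * ∑ (suc n) (λ i → A i * B (n ∸ i))
  ≡⟨ *-distribˡ-∑ (suc n) (+ n) (λ i → A i * B (n ∸ i)) ⟩
    ∑ (suc n) (λ i → + n * (A i * B (n ∸ i)))
  ≡⟨ ∑-cong-< (suc n) split-weight ⟩
    ∑ (suc n) (λ i → ∂ A i * B (n ∸ i) + A i * ∂ B (n ∸ i))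
  ≡⟨ ∑-distrib-+ (suc n) (λ i → ∂ A i * B (n ∸ i)) (λ i → A i * ∂ B (n ∸ i)) ⟩
    ∑ (suc n) (λ i → ∂ A i * B (n ∸ i)) + ∑ (suc n) (λ i → A i * ∂ B (n ∸ i))
  ≡⟨ cong₂ _+_ (⊛-coeff (∂ A) B n) (⊛-coeff A (∂ B) n) ⟨
    (∂ A ⊛ B) n + (A ⊛ ∂ B) n ∎
  where
  open ≡-Reasoning
  [x+y]*[a*b]≡x*a*b+a*[y*b] : ∀ x y a b → (x + y) * (a * b) ≡ x * a * b + a * (y * b)
  [x+y]*[a*b]≡x*a*b+a*[y*b] = solve 4 (λ x y a b → (x :+ y) :* (a :* b) := x :* a :* b :+ a :* (y :* b)) refl
  split-weight : ∀ i → i < suc n → + n * (A i * B (n ∸ i)) ≡ ∂ A i * B (n ∸ i) + A i * ∂ B (n ∸ i)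
  split-weight i i<sn = trans
    (cong (λ t → + t * (A i * B (n ∸ i))) (sym (ℕP.m+[n∸m]≡n (ℕP.≤-pred i<sn))))
    ([x+y]*[a*b]≡x*a*b+a*[y*b] (+ i) (+ (n ∸ i)) (A i) (B (n ∸ i)))

∂-^ˢ : ∀ B k → ∂ (B ^ˢ suc k) ≈ (+ suc k) · (∂ B ⊛ (B ^ˢ k))
∂-^ˢ B zero n = begin
    + n * (B ⊛ one) n      ≡⟨ cong (+ n *_) (⊛-identityʳ B n) ⟩
    ∂ B n                  ≡⟨ ⊛-identityʳ (∂ B) n ⟨
    (∂ B ⊛ one) n          ≡⟨ *-identityˡ _ ⟨
    + 1 * (∂ B ⊛ one) n    ∎
  where open ≡-Reasoning
∂-^ˢ B (suc k) n = begin
    ∂ (B ⊛ Bᵏ⁺¹) n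
  ≡⟨ ∂-⊛ B Bᵏ⁺¹ n ⟩
    x + (B ⊛ ∂ Bᵏ⁺¹) n
  ≡⟨ cong (_+_ x) (⊛-congˡ B (∂-^ˢ B k) n) ⟩
    x + (B ⊛ ((+ suc k) · (∂ B ⊛ (B ^ˢ k)))) n
  ≡⟨ cong (_+_ x) (⊛-· B (+ suc k) (∂ B ⊛ (B ^ˢ k)) n) ⟩
    x + + suc k * (B ⊛ (∂ B ⊛ (B ^ˢ k))) n
  ≡⟨ cong (λ t → x + + suc k * t) (⊛-lcomm B (∂ B) (B ^ˢ k) n) ⟩
    x + + suc k * x
  ≡⟨ solve 2 (λ x c → x :+ c :* x := (con (+ 1) :+ c) :* x) refl x (+ suc k) ⟩
    + suc (suc k) * x ∎
  where
  open ≡-Reasoning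
  Bᵏ⁺¹ = B ^ˢ suc k
  x = (∂ B ⊛ Bᵏ⁺¹) n

DivisibleOn : ℕ → (ℕ → Set) → Series → Set
DivisibleOn ℓ P X = ∀ m → P m → + ℓ ∣ℤ X m

-- X is congruent modulo ℓ to a power series in q^ℓ.
Sparse : ℕ → Series → Set
Sparse ℓ = DivisibleOn ℓ (λ m → ¬ ℓ ∣ m)

sparse-cong : ∀ {ℓ A B} → A ≈ B → Sparse ℓ A → Sparse ℓ B
sparse-cong A≈B sparse m ℓ∤m = subst (_ ∣ℤ_) (A≈B m) (sparse m ℓ∤m)

sparse-one : ∀ ℓ → Sparse ℓ one
sparse-one ℓ zero    ℓ∤0 = ⊥-elim (ℓ∤0 (ℓ ∣0))
sparse-one ℓ (suc m) _   = ∣ᵤ⇒∣ (ℓ ∣0)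

-- Modulo ℓ, the coefficient of q^m in A ⊛ B only sees the terms A i B (m - i) with ℓ ∣ i.
sparse-⊛-divisibleOn : ∀ {ℓ P A B} → (∀ {m i} → P m → ℓ ∣ i → i ≤ m → P (m ∸ i)) →
  Sparse ℓ A → DivisibleOn ℓ P B → DivisibleOn ℓ P (A ⊛ B)
sparse-⊛-divisibleOn {ℓ} {P} {A} {B} P-closed A-sparse B-div m Pm =
  subst (_ ∣ℤ_) (sym (⊛-coeff A B m)) (∑-∣ (suc m) _ term)
  where
  term : ∀ i → i < suc m → + ℓ ∣ℤ A i * B (m ∸ i)
  term i i<sm with ℓ ∣? i
  ... | no ℓ∤i = ℤ∣.∣m⇒∣m*n (B (m ∸ i)) (A-sparse i ℓ∤i)
  ... | yes ℓ∣i = ℤ∣.∣n⇒∣m*n (A i) (B-div (m ∸ i) (P-closed Pm ℓ∣i (ℕP.≤-pred i<sm)))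

sparse-⊛ : ∀ {ℓ A B} → Sparse ℓ A → Sparse ℓ B → Sparse ℓ (A ⊛ B)
sparse-⊛ {ℓ} = sparse-⊛-divisibleOn non-multiple-closed
  where
  non-multiple-closed : ∀ {m i} → ¬ ℓ ∣ m → ℓ ∣ i → i ≤ m → ¬ ℓ ∣ m ∸ i
  non-multiple-closed ℓ∤m ℓ∣i i≤m ℓ∣m∸i = ℓ∤m (∣m∸n∣n⇒∣m ℓ i≤m ℓ∣m∸i ℓ∣i)

^ˢ-sparse : ∀ {ℓ} → Prime ℓ → ∀ B → Sparse ℓ (B ^ˢ ℓ)
^ˢ-sparse {suc k} ℓ-prime B m ℓ∤m with euclidsLemma m ∣ (B ^ˢ suc k) m ∣ ℓ-prime ℓ∣m*bₘ
  where
  ℓ∣m*bₘ : suc k ∣ m ℕ.* ∣ (B ^ˢ suc k) m ∣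
  ℓ∣m*bₘ = subst (suc k ∣_) ℓ*c≡m*bₘ (m∣m*n ∣ (∂ B ⊛ (B ^ˢ k)) m ∣)
    where
    open ≡-Reasoning
    ℓ*c≡m*bₘ : suc k ℕ.* ∣ (∂ B ⊛ (B ^ˢ k)) m ∣ ≡ m ℕ.* ∣ (B ^ˢ suc k) m ∣
    ℓ*c≡m*bₘ = begin
      suc k ℕ.* ∣ (∂ B ⊛ (B ^ˢ k)) m ∣    ≡⟨ abs-* (+ suc k) ((∂ B ⊛ (B ^ˢ k)) m) ⟨
      ∣ + suc k * (∂ B ⊛ (B ^ˢ k)) m ∣    ≡⟨ cong ∣_∣ (∂-^ˢ B k m) ⟨
      ∣ + m * (B ^ˢ suc k) m ∣            ≡⟨ abs-* (+ m) ((B ^ˢ suc k) m) ⟩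
      m ℕ.* ∣ (B ^ˢ suc k) m ∣            ∎
... | inj₁ ℓ∣m  = ⊥-elim (ℓ∤m ℓ∣m)
... | inj₂ ℓ∣bₘ = ∣ᵤ⇒∣ ℓ∣bₘ

^ˢ-*-sparse : ∀ {ℓ} → Prime ℓ → ∀ B k → Sparse ℓ (B ^ˢ (k ℕ.* ℓ))
^ˢ-*-sparse {ℓ} ℓ-prime B zero    = sparse-one ℓ
^ˢ-*-sparse {ℓ} ℓ-prime B (suc k) =
  sparse-cong (≈-sym (^ˢ-+ B ℓ (k ℕ.* ℓ))) (sparse-⊛ (^ˢ-sparse ℓ-prime B) (^ˢ-*-sparse ℓ-prime B k))

geom-0 : ∀ m → geom m 0 ≡ + 1
geom-0 m rewrite dec-true (m ∣? 0) (m ∣0) = refl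

geom-< : ∀ m i → suc i < m → geom m (suc i) ≡ + 0
geom-< m i i<m rewrite dec-false (m ∣? suc i) (λ m∣i → ℕP.<⇒≱ i<m (∣⇒≤ m∣i)) = refl

geom-+ : ∀ m i → geom m (m ℕ.+ i) ≡ geom m i
geom-+ m i with m ∣? i
... | yes m∣i rewrite dec-true (m ∣? m ℕ.+ i) (∣m∣n⇒∣m+n ∣-refl m∣i) = refl
... | no m∤i rewrite dec-false (m ∣? m ℕ.+ i) (λ m∣m+i → m∤i (∣m+n∣m⇒∣n m∣m+i ∣-refl)) = refl

∑-geom-head : ∀ m s (h : ℕ → ℤ) → s < m → ∑ (suc s) (λ i → geom m i * h i) ≡ h 0
∑-geom-head m s h s<m = begin
    ∑ (suc s) (λ i → geom m i * h i)
  ≡⟨ ∑-suc s _ ⟩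
    geom m 0 * h 0 + ∑ s (λ i → geom m (suc i) * h (suc i))
  ≡⟨ cong₂ _+_ (trans (cong (_* h 0) (geom-0 m)) (*-identityˡ (h 0)))
       (∑-zero s _ (λ i i<s → trans (cong (_* h (suc i)) (geom-< m i (ℕP.≤-trans (s≤s i<s) s<m)))
                                    (*-zeroˡ (h (suc i))))) ⟩
    h 0 + + 0
  ≡⟨ +-identityʳ (h 0) ⟩
    h 0 ∎
  where open ≡-Reasoning

∑-geom : ∀ m q s (h : ℕ → ℤ) → s < m →
  ∑ (suc (q ℕ.* m ℕ.+ s)) (λ i → geom m i * h i) ≡ ∑ (suc q) (λ j → h (j ℕ.* m))
∑-geom m       zero    s h s<m = trans (∑-geom-head m s h s<m) (sym (∑-one _))
∑-geom (suc N) (suc q) s h s<m = begin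
    ∑ (suc (m ℕ.+ q ℕ.* m ℕ.+ s)) (λ i → geom m i * h i)
  ≡⟨ cong (λ t → ∑ t (λ i → geom m i * h i))
       (trans (cong suc (ℕP.+-assoc m (q ℕ.* m) s)) (sym (ℕP.+-suc m (q ℕ.* m ℕ.+ s)))) ⟩
    ∑ (m ℕ.+ suc (q ℕ.* m ℕ.+ s)) (λ i → geom m i * h i)
  ≡⟨ ∑-split m (suc (q ℕ.* m ℕ.+ s)) (λ i → geom m i * h i) ⟩
    ∑ m (λ i → geom m i * h i) + ∑ (suc (q ℕ.* m ℕ.+ s)) (λ i → geom m (m ℕ.+ i) * h (m ℕ.+ i))
  ≡⟨ cong₂ _+_ (∑-geom-head m N h ℕP.≤-refl)
               (∑-cong (suc (q ℕ.* m ℕ.+ s)) (λ i → cong (_* h (m ℕ.+ i)) (geom-+ m i))) ⟩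
    h 0 + ∑ (suc (q ℕ.* m ℕ.+ s)) (λ i → geom m i * h (m ℕ.+ i))
  ≡⟨ cong (_+_ (h 0)) (∑-geom m q s (λ i → h (m ℕ.+ i)) s<m) ⟩
    h 0 + ∑ (suc q) (λ j → h (m ℕ.+ j ℕ.* m))
  ≡⟨ ∑-suc (suc q) _ ⟨
    ∑ (suc (suc q)) (λ j → h (j ℕ.* m)) ∎
  where
  open ≡-Reasoning
  m = suc N

+sum≡∑ : ∀ (g : ℕ → ℕ) k → + sum (map g (upTo k)) ≡ ∑ k (λ j → + g j)
+sum≡∑ g k = trans (go (applyUpTo (λ j → j) k)) (sumℤ-applyUpTo k (λ j → + g j) (λ j → j))
  where
  go : ∀ xs → + sum (map g xs) ≡ sumℤ (map (λ j → + g j) xs)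
  go []       = refl
  go (x ∷ xs) = cong (_+_ (+ g x)) (go xs)

pBounded-suc : ∀ n N →
  pBounded n (suc N) ≡ sum (map (λ j → pBounded (n ∸ j ℕ.* suc N) N) (upTo (suc (n / suc N))))
pBounded-suc zero    N = refl
pBounded-suc (suc n) N = refl

invF1Trunc≡pBounded : ∀ N n → invF1Trunc N n ≡ + pBounded n N
invF1Trunc≡pBounded zero    zero    = refl
invF1Trunc≡pBounded zero    (suc n) = refl
invF1Trunc≡pBounded (suc N) n = begin
    (geom m ⊛ invF1Trunc N) n
  ≡⟨ ⊛-coeff (geom m) (invF1Trunc N) n ⟩
    ∑ (suc n) (λ i → geom m i * invF1Trunc N (n ∸ i))
  ≡⟨ ∑-cong (suc n) (λ i → cong (geom m i *_) (invF1Trunc≡pBounded N (n ∸ i))) ⟩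
    ∑ (suc n) (λ i → geom m i * h i)
  ≡⟨ cong (λ t → ∑ (suc t) (λ i → geom m i * h i)) (trans (m≡m%n+[m/n]*n n m) (ℕP.+-comm (n % m) _)) ⟩
    ∑ (suc (n / m ℕ.* m ℕ.+ n % m)) (λ i → geom m i * h i)
  ≡⟨ ∑-geom m (n / m) (n % m) h (m%n<n n m) ⟩
    ∑ (suc (n / m)) (λ j → h (j ℕ.* m))
  ≡⟨ +sum≡∑ (λ j → pBounded (n ∸ j ℕ.* m) N) (suc (n / m)) ⟨
    + sum (map (λ j → pBounded (n ∸ j ℕ.* m) N) (upTo (suc (n / m))))
  ≡⟨ cong +_ (pBounded-suc n N) ⟨
    + pBounded n m ∎
  where
  open ≡-Reasoning
  m = suc N
  h : ℕ → ℤ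
  h i = + pBounded (n ∸ i) N

invF1≡p : ∀ n → invF1 n ≡ + p n
invF1≡p n = invF1Trunc≡pBounded n n

∸-multiple-preserves-residue : ∀ ℓ .{{_ : NonZero ℓ}} r {m i} →
  m % ℓ ≡ r → ℓ ∣ i → i ≤ m → (m ∸ i) % ℓ ≡ r
∸-multiple-preserves-residue ℓ r m%ℓ≡r (divides q refl) i≤m = trans (m*n≤o⇒[o∸m*n]%n≡o%n q i≤m) m%ℓ≡r

[m*q+r]%m≡r : ∀ m .{{_ : NonZero m}} q {r} → r < m → (m ℕ.* q ℕ.+ r) % m ≡ r
[m*q+r]%m≡r m q {r} r<m = begin
  (m ℕ.* q ℕ.+ r) % m   ≡⟨ cong (_% m) (trans (ℕP.+-comm (m ℕ.* q) r) (cong (r ℕ.+_) (ℕP.*-comm m q))) ⟩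
  (r ℕ.+ q ℕ.* m) % m   ≡⟨ [m+kn]%n≡m%n r q m ⟩
  r % m                 ≡⟨ m<n⇒m%n≡m r<m ⟩
  r                     ∎
  where open ≡-Reasoning

invF1-divisibleOn-residue : ∀ ℓ .{{_ : NonZero ℓ}} r → (∀ n → ℓ ∣ p (ℓ ℕ.* n ℕ.+ r)) →
  DivisibleOn ℓ (λ m → m % ℓ ≡ r) invF1
invF1-divisibleOn-residue ℓ r ℓ∣p m m%ℓ≡r =
  subst (+ ℓ ∣ℤ_) (sym (invF1≡p m)) (∣ᵤ⇒∣ (subst (λ t → ℓ ∣ p t) ℓ*[m/ℓ]+r≡m (ℓ∣p (m / ℓ))))
  where
  ℓ*[m/ℓ]+r≡m : ℓ ℕ.* (m / ℓ) ℕ.+ r ≡ m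
  ℓ*[m/ℓ]+r≡m = trans (ℕP.+-comm _ r)
    (trans (cong₂ ℕ._+_ (sym m%ℓ≡r) (ℕP.*-comm ℓ (m / ℓ))) (sym (m≡m%n+[m/n]*n m ℓ)))

d≈f₂^ℓ⊛invF1^3ℓ⊛invF1 : ∀ ℓ → d ℓ ≈ ((f 2 ^ˢ ℓ) ⊛ (invF1 ^ˢ (3 ℕ.* ℓ))) ⊛ invF1
d≈f₂^ℓ⊛invF1^3ℓ⊛invF1 ℓ = ≈-trans
  (⊛-congˡ (f 2 ^ˢ ℓ) (≈-trans (^ˢ-+ invF1 (3 ℕ.* ℓ) 1) (⊛-congˡ (invF1 ^ˢ (3 ℕ.* ℓ)) (⊛-identityʳ invF1))))
  (≈-sym (⊛-assoc (f 2 ^ˢ ℓ) (invF1 ^ˢ (3 ℕ.* ℓ)) invF1))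

theorem3p2 : (ℓ r : ℕ) → Prime ℓ → 1 ≤ r → r ≤ ℓ ∸ 1 →
    (∀ n → ℓ ∣ p (ℓ ℕ.* n ℕ.+ r)) →
    ∀ n → (+ ℓ) ℤD.∣ d ℓ (ℓ ℕ.* n ℕ.+ r)
theorem3p2 zero    r ()
theorem3p2 ℓ@(suc k) r ℓ-prime _ r≤k ℓ∣p n =
  ∣⇒∣ᵤ (subst (+ ℓ ∣ℤ_) (sym (d≈f₂^ℓ⊛invF1^3ℓ⊛invF1 ℓ N)) coeff-divisible)
  where
  N = ℓ ℕ.* n ℕ.+ r
  G-sparse : Sparse ℓ ((f 2 ^ˢ ℓ) ⊛ (invF1 ^ˢ (3 ℕ.* ℓ)))
  G-sparse = sparse-⊛ (^ˢ-sparse ℓ-prime (f 2)) (^ˢ-*-sparse ℓ-prime invF1 3)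
  coeff-divisible : + ℓ ∣ℤ (((f 2 ^ˢ ℓ) ⊛ (invF1 ^ˢ (3 ℕ.* ℓ))) ⊛ invF1) N
  coeff-divisible = sparse-⊛-divisibleOn (∸-multiple-preserves-residue ℓ r) G-sparse
    (invF1-divisibleOn-residue ℓ r ℓ∣p) N ([m*q+r]%m≡r ℓ n (s≤s r≤k))
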